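{- Node~$x$ is accessed at most once in any position other than the root or the root's right child.
   Context: BST model: an $n$-node BST on keys $\{1,\dots,n\}$; the $i$-th search for $s_i$ accesses a subtree $\tau_i$ containing the root and $s_i$ (the search path) and reconfigures it into a tree $\tau'_i$ on the same nodes. GreedyFuture is the offline BST algorithm that touches only the search path $\tau_i$ and then rearranges it: if $s_{i+1}\in\tau_i$ it makes $s_{i+1}$ the root of $\tau'_i$; otherwise it makes the predecessor and successor of $s_{i+1}$ within $\tau_i$ the root and the root's right child (only one if the other does not exist); it then recursively arranges the remaining nodes less than / greater than these fixed nodes using the corresponding subsequences of future searches. Here GreedyFuture is run on the search sequence $S=\langle1,2,\dots,n\rangle$ starting from an arbitrary BST $T_0$, with resulting trees $T_0,T_1,\dots,T_n$; the claim concerns accesses over all $n$ searches. -}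

module Defs where

open import Data.Nat using (ℕ; zero; suc; _+_; _∸_; _<ᵇ_; _≡ᵇ_; _⊔_; _⊓_; _<_; _≤_)
open import Data.Bool using (Bool; true; false; if_then_else_)
open import Data.List using (List; []; _∷_; _++_; [_]; filterᵇ; length; map; upTo)
open import Data.Bool.ListAction using (any)
open import Data.Maybe using (Maybe; just; nothing)
open import Data.Product using (_×_; _,_; proj₁)
open import Relation.Binary.PropositionalEquality using (_≡_)
open import Relation.Nullary using (¬_)
open import Data.Empty using (⊥)
open import Data.Sum using (_⊎_)
open import Data.List.Membership.Propositional using (_∈_)

data Tree : Set where
  leaf : Tree
  node : Tree → ℕ → Tree → Tree

-- In-order traversal.  A BST on keys {1,…,n} is a tree t with
-- inorder t ≡ map suc (upTo n)  (i.e. the list 1,2,…,n).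
inorder : Tree → List ℕ
inorder leaf = []
inorder (node l x r) = inorder l ++ (x ∷ inorder r)

IsBSTOn : ℕ → Tree → Set
IsBSTOn n t = inorder t ≡ map suc (upTo n)

pathKeys : ℕ → Tree → List ℕ
pathKeys k leaf = []
pathKeys k (node l x r) with k <ᵇ x | x <ᵇ k
... | true  | _     = x ∷ pathKeys k l
... | false | true  = x ∷ pathKeys k r
... | false | false = x ∷ []

-- The subtrees hanging off the search path, in symmetric (in-order) order.
-- A path with m nodes has m+1 hanging subtrees (possibly leaves).
offPath : ℕ → Tree → List Tree
offPath k leaf = leaf ∷ []
offPath k (node l x r) with k <ᵇ x | x <ᵇ k
... | true  | _     = offPath k l ++ (r ∷ [])
... | false | true  = l ∷ offPath k r
... | false | false = l ∷ r ∷ []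

maxL : List ℕ → Maybe ℕ
maxL [] = nothing
maxL (x ∷ xs) with maxL xs
... | nothing = just x
... | just m  = just (x ⊔ m)

minL : List ℕ → Maybe ℕ
minL [] = nothing
minL (x ∷ xs) with minL xs
... | nothing = just x
... | just m  = just (x ⊓ m)

below above : ℕ → List ℕ → List ℕ
below s = filterᵇ (λ p → p <ᵇ s)
above s = filterᵇ (λ p → s <ᵇ p)

-- GreedyFuture arrangement of the key set P (of the accessed subtree) given the
-- future search sequence σ.  The first argument is fuel (length P suffices, since
-- every level places at least one key).  If σ is empty (no future search is
-- relevant) we use the convention that the next search is 0, i.e. smaller than
-- every key: the minimum becomes the root (the arrangement is then irrelevant).
build : ℕ → List ℕ → List ℕ → Tree
build zero P σ = leaf
build (suc f) [] σ = leaf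
build (suc f) (p ∷ P') σ = go σ
  where
  P = p ∷ P'
  arrange : ℕ → Tree
  arrange s with any (λ q → q ≡ᵇ s) P
  ... | true = node (build f (below s P) (below s σ)) s (build f (above s P) (above s σ))
  ... | false with maxL (below s P) | minL (above s P)
  ...   | just a  | just b  = node (build f (below a P) (below a σ)) a
                                   (node leaf b (build f (above b P) (above b σ)))
  ...   | just a  | nothing = node (build f (below a P) (below a σ)) a leaf
  ...   | nothing | just b  = node leaf b (build f (above b P) (above b σ))
  ...   | nothing | nothing = leaf
  go : List ℕ → Tree
  go []      = arrange 0
  go (s ∷ _) = arrange s

fill : Tree → List Tree → Tree × List Tree
fill leaf [] = leaf , []
fill leaf (h ∷ hs) = h , hs
fill (node l x r) hs with fill l hs
... | l' , hs₁ with fill r hs₁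
...   | r' , hs₂ = node l' x r' , hs₂

-- One GreedyFuture step: search for k in t, then rearrange the search path τ
-- according to the future searches σ, re-attaching the hanging subtrees.
step : Tree → ℕ → List ℕ → Tree
step t k σ = proj₁ (fill (build (length P) P σ) (offPath k t))
  where P = pathKeys k t

futureAfter : ℕ → ℕ → List ℕ
futureAfter n k = map (λ j → suc k + j) (upTo (n ∸ k))

-- trees n T₀ i = T_i: the tree after the first i searches of ⟨1,…,n⟩.
trees : ℕ → Tree → ℕ → Tree
trees n T₀ zero = T₀
trees n T₀ (suc i) = step (trees n T₀ i) (suc i) (futureAfter n (suc i))

RootOrRightChild : ℕ → Tree → Set
RootOrRightChild x leaf = ⊥
RootOrRightChild x (node l y leaf) = x ≡ y
RootOrRightChild x (node l y (node rl z rr)) = (x ≡ y) ⊎ (x ≡ z)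

-- Search number (suc i) (for key suc i, performed on T_i) accesses x
-- in a position other than the root or the root's right child of T_i.
AccessedDeep : ℕ → Tree → ℕ → ℕ → Set
AccessedDeep n T₀ x i =
  (x ∈ pathKeys (suc i) (trees n T₀ i)) × ¬ RootOrRightChild x (trees n T₀ i)

module Submission where

-- Call a key x settled after search m if x ≤ m, or x lies on the
-- right spine of T_m.  (1) Accessing x in search m+1 settles it: the later searches
-- m+2, …, n are consecutive, and GreedyFuture puts every accessed key larger than the
-- current search on the right spine of the rearranged path ('build-spine'), which
-- becomes the top of the right spine of T_{m+1}.  (2) Settled keys stay settled: a
-- right-spine key of T_m is either accessed again, or it sits on the right spine of
-- the rightmost hanging subtree, which stays the bottom of the right spine.  (3) For
-- j ≥ 1 the root of T_j is j or j+1 ('build-root'), and on the search path to j+1 in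
-- such a tree every settled key is the root or the root's right child.

open import Defs
open import Data.Nat
  using (ℕ; zero; suc; _+_; _∸_; _<ᵇ_; _≡ᵇ_; _⊔_; _⊓_; _<_; _≤_; _≤′_; ≤′-refl; ≤′-step; _≤?_; s≤s; z<s)
open import Data.Nat.Properties
open import Data.Bool using (Bool; true; false; T)
open import Data.Bool.Properties using (T-≡)
open import Data.Bool.ListAction using (any)
open import Data.List using (List; []; _∷_; _++_; length; map; upTo; applyUpTo)
open import Data.List.Properties using (++-assoc; length-++; ++-identityʳ; filter-notAll)
open import Data.List.Relation.Unary.All as All using (All; []; _∷_)
open import Data.List.Relation.Unary.Any as Any using (here; there)
open import Data.List.Relation.Unary.Any.Properties using (any⁺; any⁻)
open import Data.List.Relation.Unary.AllPairs as AllPairs using (AllPairs; []; _∷_)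
import Data.List.Relation.Unary.AllPairs.Properties as AllPairsₚ
open import Data.List.Membership.Propositional using (_∈_; _∉_)
open import Data.List.Membership.Propositional.Properties
  using (∈-++⁺ˡ; ∈-++⁺ʳ; ∈-++⁻; ∈-map⁺; ∈-map⁻; ∈-upTo⁺; ∈-upTo⁻; ∈-filter⁺; ∈-filter⁻)
open import Data.List.Relation.Binary.Subset.Propositional using (_⊆_)
open import Data.Maybe using (Maybe; just; nothing)
open import Data.Maybe.Properties using (just-injective)
open import Data.Product using (_×_; _,_; proj₁; proj₂; ∃; ∃₂)
open import Data.Sum as Sum using (_⊎_; inj₁; inj₂; [_,_]′)
open import Data.Empty using (⊥; ⊥-elim)
open import Function using (_∘_; case_of_)
open import Function.Bundles using (Equivalence)
open import Relation.Binary.PropositionalEquality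
open import Relation.Binary.Definitions using (tri<; tri≈; tri>)
open import Relation.Nullary using (¬_; yes; no)
open import Relation.Nullary.Decidable using (T?)

data Order (k x : ℕ) : Bool → Bool → Set where
  lt : ∀ {b} → k < x → Order k x true b
  gt : x < k → Order k x false true
  eq : k ≡ x → Order k x false false

order : ∀ k x → Order k x (k <ᵇ x) (x <ᵇ k)
order k x with k <ᵇ x in k<ᵇx | x <ᵇ k in x<ᵇk
... | true  | _     = lt (<ᵇ⇒< k x (Equivalence.from T-≡ k<ᵇx))
... | false | true  = gt (<ᵇ⇒< x k (Equivalence.from T-≡ x<ᵇk))
... | false | false = eq (≤-antisym (≮⇒≥ (not-lt x<ᵇk)) (≮⇒≥ (not-lt k<ᵇx)))
  where
  not-lt : ∀ {m n} → (m <ᵇ n) ≡ false → ¬ m < n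
  not-lt m<ᵇn≡false m<n = subst T m<ᵇn≡false (<⇒<ᵇ m<n)

Increasing : List ℕ → Set
Increasing = AllPairs _<_

_≈_ : List ℕ → List ℕ → Set
xs ≈ ys = xs ⊆ ys × ys ⊆ xs

-- An increasing list is determined by its elements; this identifies the in-order
-- traversal of the rearranged search path with that of the old one.
increasing-unique : ∀ {xs ys} → Increasing xs → Increasing ys → xs ≈ ys → xs ≡ ys
increasing-unique [] [] _ = refl
increasing-unique [] (_ ∷ _) (_ , ys⊆xs) = case ys⊆xs (here refl) of λ ()
increasing-unique (_ ∷ _) [] (xs⊆ys , _) = case xs⊆ys (here refl) of λ ()
increasing-unique {x ∷ xs} {y ∷ ys} (x<xs ∷ incxs) (y<ys ∷ incys) (xs⊆ys , ys⊆xs) =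
  cong₂ _∷_ x≡y (increasing-unique incxs incys (tail⊆ x≡y x<xs xs⊆ys , tail⊆ (sym x≡y) y<ys ys⊆xs))
  where
  x≡y : x ≡ y
  x≡y with xs⊆ys (here refl) | ys⊆xs (here refl)
  ... | here x≡y   | _          = x≡y
  ... | there _    | here y≡x   = sym y≡x
  ... | there x∈ys | there y∈xs = ⊥-elim (<-asym (All.lookup y<ys x∈ys) (All.lookup x<xs y∈xs))
  tail⊆ : ∀ {a as b bs} → a ≡ b → All (a <_) as → a ∷ as ⊆ b ∷ bs → as ⊆ bs
  tail⊆ refl a<as sub z∈as with sub (there z∈as)
  ... | here z≡a  = ⊥-elim (<-irrefl (sym z≡a) (All.lookup a<as z∈as))
  ... | there z∈bs = z∈bs

head-least : ∀ {s σ z} → Increasing (s ∷ σ) → z ∈ s ∷ σ → s ≤ z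
head-least _            (here refl) = ≤-refl
head-least (s<σ ∷ _) (there z∈σ) = <⇒≤ (All.lookup s<σ z∈σ)

increasing-++⁻ : ∀ xs {ys} → Increasing (xs ++ ys) →
  Increasing xs × Increasing ys × (∀ {a b} → a ∈ xs → b ∈ ys → a < b)
increasing-++⁻ [] inc = [] , inc , λ ()
increasing-++⁻ (x ∷ xs) (x<rest ∷ inc) with increasing-++⁻ xs inc
... | incxs , incys , xs<ys =
  All.tabulate (All.lookup x<rest ∘ ∈-++⁺ˡ) ∷ incxs , incys ,
  λ { (here refl) b∈ys → All.lookup x<rest (∈-++⁺ʳ xs b∈ys)
    ; (there a∈xs) b∈ys → xs<ys a∈xs b∈ys }

Separates : Tree → ℕ → Tree → Set
Separates l x r = (∀ {y} → y ∈ inorder l → y < x) × (∀ {y} → y ∈ inorder r → x < y)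

increasing-node⁺ : ∀ {l x r} → Increasing (inorder l) → Increasing (inorder r) → Separates l x r →
  Increasing (inorder (node l x r))
increasing-node⁺ incl incr (l<x , x<r) =
  AllPairsₚ.++⁺ incl (All.tabulate x<r ∷ incr)
    (All.tabulate λ y∈l → l<x y∈l ∷ All.tabulate λ z∈r → <-trans (l<x y∈l) (x<r z∈r))

increasing-node⁻ : ∀ {l x r} → Increasing (inorder (node l x r)) →
  Increasing (inorder l) × Increasing (inorder r) × Separates l x r
increasing-node⁻ {l} inc with increasing-++⁻ (inorder l) inc
... | incl , (x<r ∷ incr) , l<xr = incl , incr , (λ y∈l → l<xr y∈l (here refl)) , All.lookup x<r

key∈node : ∀ l {x} r → x ∈ inorder (node l x r)
key∈node l r = ∈-++⁺ʳ (inorder l) (here refl)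

∈-node⁻ : ∀ l {x} r {y} → y ∈ inorder (node l x r) → y ∈ inorder l ⊎ y ≡ x ⊎ y ∈ inorder r
∈-node⁻ l r y∈ with ∈-++⁻ (inorder l) y∈
... | inj₁ y∈l          = inj₁ y∈l
... | inj₂ (here y≡x)   = inj₂ (inj₁ y≡x)
... | inj₂ (there y∈r)  = inj₂ (inj₂ y∈r)

rspine : Tree → List ℕ
rspine leaf = []
rspine (node l x r) = x ∷ rspine r

root : Tree → Maybe ℕ
root leaf = nothing
root (node l x r) = just x

rspine⊆inorder : ∀ t → rspine t ⊆ inorder t
rspine⊆inorder (node l x r) (here refl) = key∈node l r
rspine⊆inorder (node l x r) (there y∈) = ∈-++⁺ʳ (inorder l) (there (rspine⊆inorder r y∈))

left-off-spine : ∀ {l x r y} → Increasing (inorder (node l x r)) → y ∈ inorder l → y ∉ rspine (node l x r)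
left-off-spine {l} {x} {r} inc y∈l y∈spine with increasing-node⁻ {l} {x} {r} inc | y∈spine
... | _ , _ , l<x , _   | here refl = <-irrefl refl (l<x y∈l)
... | _ , _ , l<x , x<r | there y∈ = <-asym (l<x y∈l) (x<r (rspine⊆inorder r y∈))

path⊆inorder : ∀ k t → pathKeys k t ⊆ inorder t
path⊆inorder k (node l x r) y∈ with k <ᵇ x | x <ᵇ k | y∈
... | true  | _     | here refl = key∈node l r
... | true  | _     | there y∈l = ∈-++⁺ˡ (path⊆inorder k l y∈l)
... | false | true  | here refl = key∈node l r
... | false | true  | there y∈r = ∈-++⁺ʳ (inorder l) (there (path⊆inorder k r y∈r))
... | false | false | here refl = key∈node l r

key-on-path : ∀ k t → Increasing (inorder t) → k ∈ inorder t → k ∈ pathKeys k t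
key-on-path k (node l x r) inc k∈
  with k <ᵇ x | x <ᵇ k | order k x | ∈-node⁻ l r k∈ | increasing-node⁻ {l} {x} {r} inc
... | true  | _     | lt _   | inj₁ k∈l        | incl , _ = there (key-on-path k l incl k∈l)
... | true  | _     | lt k<x | inj₂ (inj₁ refl) | _ = ⊥-elim (<-irrefl refl k<x)
... | true  | _     | lt k<x | inj₂ (inj₂ k∈r) | _ , _ , _ , x<r = ⊥-elim (<-asym k<x (x<r k∈r))
... | false | true  | gt x<k | inj₁ k∈l        | _ , _ , l<x , _ = ⊥-elim (<-asym x<k (l<x k∈l))
... | false | true  | gt x<k | inj₂ (inj₁ refl) | _ = ⊥-elim (<-irrefl refl x<k)
... | false | true  | gt _   | inj₂ (inj₂ k∈r) | _ , incr , _ = there (key-on-path k r incr k∈r)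
... | false | false | eq k≡x | _ | _ = here k≡x

∈-below⁻ : ∀ {s P y} → y ∈ below s P → y ∈ P × y < s
∈-below⁻ {s} y∈ with ∈-filter⁻ (λ z → T? (z <ᵇ s)) y∈
... | y∈P , y<ᵇs = y∈P , <ᵇ⇒< _ s y<ᵇs

∈-below⁺ : ∀ {s P y} → y ∈ P → y < s → y ∈ below s P
∈-below⁺ {s} y∈P y<s = ∈-filter⁺ (λ z → T? (z <ᵇ s)) y∈P (<⇒<ᵇ y<s)

∈-above⁻ : ∀ {s P y} → y ∈ above s P → y ∈ P × s < y
∈-above⁻ {s} y∈ with ∈-filter⁻ (λ z → T? (s <ᵇ z)) y∈
... | y∈P , s<ᵇy = y∈P , <ᵇ⇒< s _ s<ᵇy

∈-above⁺ : ∀ {s P y} → y ∈ P → s < y → y ∈ above s P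
∈-above⁺ {s} y∈P s<y = ∈-filter⁺ (λ z → T? (s <ᵇ z)) y∈P (<⇒<ᵇ s<y)

-- Filtering around a present key shortens the list; this pays for the fuel of 'build'.
length-below : ∀ {s P} → s ∈ P → length (below s P) < length P
length-below {s} {P} s∈P =
  filter-notAll (λ z → T? (z <ᵇ s)) P (Any.map (λ { refl → <-irrefl refl ∘ <ᵇ⇒< s s }) s∈P)

length-above : ∀ {s P} → s ∈ P → length (above s P) < length P
length-above {s} {P} s∈P =
  filter-notAll (λ z → T? (s <ᵇ z)) P (Any.map (λ { refl → <-irrefl refl ∘ <ᵇ⇒< s s }) s∈P)

increasing-above : ∀ {s σ} → Increasing σ → Increasing (above s σ)
increasing-above {s} = AllPairsₚ.filter⁺ (λ z → T? (s <ᵇ z))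

above-above : ∀ {a b P} → a < b → above b P ≈ above b (above a P)
above-above {a} {b} {P} a<b = grow , shrink
  where
  shrink : above b (above a P) ⊆ above b P
  shrink y∈ with ∈-above⁻ {b} {above a P} y∈
  ... | y∈aP , b<y = ∈-above⁺ (proj₁ (∈-above⁻ {a} {P} y∈aP)) b<y
  grow : above b P ⊆ above b (above a P)
  grow y∈ with ∈-above⁻ {b} {P} y∈
  ... | y∈P , b<y = ∈-above⁺ (∈-above⁺ y∈P (<-trans a<b b<y)) b<y

IsPred : ℕ → ℕ → List ℕ → Set
IsPred a s P = a ∈ P × a < s × (∀ {y} → y ∈ P → y < s → y ≤ a)

IsSucc : ℕ → ℕ → List ℕ → Set
IsSucc b s P = b ∈ P × s < b × (∀ {y} → y ∈ P → s < y → b ≤ y)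

NoneBelow : ℕ → List ℕ → Set
NoneBelow s P = ∀ {y} → y ∈ P → s ≤ y

NoneAbove : ℕ → List ℕ → Set
NoneAbove s P = ∀ {y} → y ∈ P → y ≤ s

miss-side : ∀ {s P y} → s ∉ P → y ∈ P → y < s ⊎ s < y
miss-side {s} {y = y} s∉P y∈P with <-cmp y s
... | tri< y<s _ _ = inj₁ y<s
... | tri≈ _ refl _ = ⊥-elim (s∉P y∈P)
... | tri> _ _ s<y = inj₂ s<y

no-key-between : ∀ {s P a b y} → s ∉ P → IsPred a s P → IsSucc b s P → y ∈ P → a < y → y < b → ⊥
no-key-between s∉P (_ , _ , a-max) (_ , _ , b-min) y∈P a<y y<b with miss-side s∉P y∈P
... | inj₁ y<s = <⇒≱ a<y (a-max y∈P y<s)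
... | inj₂ s<y = <⇒≱ y<b (b-min y∈P s<y)

no-key-above-pred : ∀ {s P a y} → s ∉ P → IsPred a s P → NoneAbove s P → y ∈ P → a < y → ⊥
no-key-above-pred s∉P (_ , _ , a-max) none y∈P a<y with miss-side s∉P y∈P
... | inj₁ y<s = <⇒≱ a<y (a-max y∈P y<s)
... | inj₂ s<y = <⇒≱ s<y (none y∈P)

no-key-below-succ : ∀ {s P b y} → s ∉ P → NoneBelow s P → IsSucc b s P → y ∈ P → y < b → ⊥
no-key-below-succ s∉P none (_ , _ , b-min) y∈P y<b with miss-side s∉P y∈P
... | inj₁ y<s = <⇒≱ y<s (none y∈P)
... | inj₂ s<y = <⇒≱ y<b (b-min y∈P s<y)

maxL-nothing : ∀ L → maxL L ≡ nothing → ∀ {y} → y ∉ L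
maxL-nothing (z ∷ L) e with maxL L
maxL-nothing (z ∷ L) () | nothing
maxL-nothing (z ∷ L) () | just _

maxL-just : ∀ L {m} → maxL L ≡ just m → m ∈ L × (∀ {y} → y ∈ L → y ≤ m)
maxL-just (x ∷ L) e with maxL L in e′
maxL-just (x ∷ L) refl | nothing =
  here refl , λ { (here refl) → ≤-refl ; (there y∈L) → ⊥-elim (maxL-nothing L e′ y∈L) }
maxL-just (x ∷ L) refl | just m with maxL-just L e′
... | m∈L , m-max =
  [ here , there ∘ (λ ≡m → subst (_∈ L) (sym ≡m) m∈L) ]′ (⊔-sel x m) ,
  λ { (here refl) → m≤m⊔n x m ; (there y∈L) → ≤-trans (m-max y∈L) (m≤n⊔m x m) }

minL-nothing : ∀ L → minL L ≡ nothing → ∀ {y} → y ∉ L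
minL-nothing (z ∷ L) e with minL L
minL-nothing (z ∷ L) () | nothing
minL-nothing (z ∷ L) () | just _

minL-just : ∀ L {m} → minL L ≡ just m → m ∈ L × (∀ {y} → y ∈ L → m ≤ y)
minL-just (x ∷ L) e with minL L in e′
minL-just (x ∷ L) refl | nothing =
  here refl , λ { (here refl) → ≤-refl ; (there y∈L) → ⊥-elim (minL-nothing L e′ y∈L) }
minL-just (x ∷ L) refl | just m with minL-just L e′
... | m∈L , m-min =
  [ here , there ∘ (λ ≡m → subst (_∈ L) (sym ≡m) m∈L) ]′ (⊓-sel x m) ,
  λ { (here refl) → m⊓n≤m x m ; (there y∈L) → ≤-trans (m⊓n≤n x m) (m-min y∈L) }

pred-of : ∀ {s P a} → maxL (below s P) ≡ just a → IsPred a s P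
pred-of {s} {P} e with maxL-just (below s P) e
... | a∈ , a-max = proj₁ (∈-below⁻ {s} {P} a∈) , proj₂ (∈-below⁻ {s} {P} a∈) ,
                   λ y∈P y<s → a-max (∈-below⁺ y∈P y<s)

succ-of : ∀ {s P b} → minL (above s P) ≡ just b → IsSucc b s P
succ-of {s} {P} e with minL-just (above s P) e
... | b∈ , b-min = proj₁ (∈-above⁻ {s} {P} b∈) , proj₂ (∈-above⁻ {s} {P} b∈) ,
                   λ y∈P s<y → b-min (∈-above⁺ y∈P s<y)

no-pred : ∀ {s P} → maxL (below s P) ≡ nothing → NoneBelow s P
no-pred {s} {P} e y∈P = ≮⇒≥ (maxL-nothing (below s P) e ∘ ∈-below⁺ y∈P)

no-succ : ∀ {s P} → minL (above s P) ≡ nothing → NoneAbove s P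
no-succ {s} {P} e y∈P = ≮⇒≥ (minL-nothing (above s P) e ∘ ∈-above⁺ y∈P)

any-≡ᵇ-true : ∀ {s P} → any (λ q → q ≡ᵇ s) P ≡ true → s ∈ P
any-≡ᵇ-true {s} {P} e =
  Any.map (λ {q} q≡ᵇs → sym (≡ᵇ⇒≡ q s q≡ᵇs)) (any⁻ _ P (Equivalence.from T-≡ e))

any-≡ᵇ-false : ∀ {s P} → any (λ q → q ≡ᵇ s) P ≡ false → s ∉ P
any-≡ᵇ-false {s} e s∈P = subst T e (any⁺ _ (Any.map (λ { refl → ≡⇒≡ᵇ s s refl }) s∈P))

no-neighbour : ∀ {s P y} → s ∉ P → NoneBelow s P → NoneAbove s P → y ∉ P
no-neighbour s∉P below≥ above≤ y∈P =
  s∉P (subst (_∈ _) (≤-antisym (above≤ y∈P) (below≥ y∈P)) y∈P)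

nextSearch : List ℕ → ℕ
nextSearch []      = 0
nextSearch (s ∷ _) = s

-- The top level of the GreedyFuture arrangement of P for the next search s: s itself
-- becomes the root, or its predecessor a with its successor b as right child, or the
-- one of them that exists.  (P nonempty rules out that neither exists.)
data Arrangement (f : ℕ) (P σ : List ℕ) (s : ℕ) : Tree → Set where
  hit      : s ∈ P →
             Arrangement f P σ s
               (node (build f (below s P) (below s σ)) s (build f (above s P) (above s σ)))
  between  : ∀ {a b} → s ∉ P → IsPred a s P → IsSucc b s P →
             Arrangement f P σ s
               (node (build f (below a P) (below a σ)) a (node leaf b (build f (above b P) (above b σ))))
  predOnly : ∀ {a} → s ∉ P → IsPred a s P → NoneAbove s P →
             Arrangement f P σ s (node (build f (below a P) (below a σ)) a leaf)
  succOnly : ∀ {b} → s ∉ P → NoneBelow s P → IsSucc b s P →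
             Arrangement f P σ s (node leaf b (build f (above b P) (above b σ)))

arrangement : ∀ f p P σ → Arrangement f (p ∷ P) σ (nextSearch σ) (build (suc f) (p ∷ P) σ)
arrangement f p P [] with any (λ q → q ≡ᵇ 0) (p ∷ P) in e
... | true = hit (any-≡ᵇ-true e)
... | false with maxL (below 0 (p ∷ P)) in ea | minL (above 0 (p ∷ P)) in eb
...   | just _  | just _  = between (any-≡ᵇ-false e) (pred-of ea) (succ-of eb)
...   | just _  | nothing = predOnly (any-≡ᵇ-false e) (pred-of ea) (no-succ eb)
...   | nothing | just _  = succOnly (any-≡ᵇ-false e) (no-pred ea) (succ-of eb)
...   | nothing | nothing =
  ⊥-elim (no-neighbour {P = p ∷ P} (any-≡ᵇ-false e) (no-pred ea) (no-succ eb) (here refl))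
arrangement f p P (s ∷ σ) with any (λ q → q ≡ᵇ s) (p ∷ P) in e
... | true = hit (any-≡ᵇ-true e)
... | false with maxL (below s (p ∷ P)) in ea | minL (above s (p ∷ P)) in eb
...   | just _  | just _  = between (any-≡ᵇ-false e) (pred-of ea) (succ-of eb)
...   | just _  | nothing = predOnly (any-≡ᵇ-false e) (pred-of ea) (no-succ eb)
...   | nothing | just _  = succOnly (any-≡ᵇ-false e) (no-pred ea) (succ-of eb)
...   | nothing | nothing =
  ⊥-elim (no-neighbour {P = p ∷ P} (any-≡ᵇ-false e) (no-pred ea) (no-succ eb) (here refl))

record BSTOf (P : List ℕ) (t : Tree) : Set where
  constructor bst
  field
    increasing : Increasing (inorder t)
    same-keys  : inorder t ≈ P

bst-leaf : ∀ {P} → (∀ {y} → y ∉ P) → BSTOf P leaf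
bst-leaf none = bst [] ((λ ()) , ⊥-elim ∘ none)

bst-resp : ∀ {P Q t} → P ≈ Q → BSTOf P t → BSTOf Q t
bst-resp (P⊆Q , Q⊆P) (bst inc (t⊆P , P⊆t)) = bst inc (P⊆Q ∘ t⊆P , P⊆t ∘ Q⊆P)

bst-node : ∀ {P l r R} → r ∈ P → BSTOf (below r P) l → BSTOf (above r P) R → BSTOf P (node l r R)
bst-node {P} {l} {r} {R} r∈P (bst incl (l⊆ , ⊆l)) (bst incR (R⊆ , ⊆R)) =
  bst (increasing-node⁺ {l} {r} {R} incl incR ((λ y∈l → proj₂ (∈-below⁻ {r} {P} (l⊆ y∈l))) ,
                                   (λ y∈R → proj₂ (∈-above⁻ {r} {P} (R⊆ y∈R)))))
      (node⊆P , P⊆node)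
  where
  node⊆P : inorder (node l r R) ⊆ P
  node⊆P y∈ with ∈-node⁻ l R y∈
  ... | inj₁ y∈l         = proj₁ (∈-below⁻ {r} {P} (l⊆ y∈l))
  ... | inj₂ (inj₁ refl) = r∈P
  ... | inj₂ (inj₂ y∈R)  = proj₁ (∈-above⁻ {r} {P} (R⊆ y∈R))
  P⊆node : P ⊆ inorder (node l r R)
  P⊆node {y} y∈P with <-cmp y r
  ... | tri< y<r _ _ = ∈-++⁺ˡ (⊆l (∈-below⁺ y∈P y<r))
  ... | tri≈ _ refl _ = key∈node l R
  ... | tri> _ _ r<y = ∈-++⁺ʳ (inorder l) (there (⊆R (∈-above⁺ y∈P r<y)))

arrangement-bst : ∀ {f Q σ s t} →
  (∀ {Q′} σ′ → length Q′ < length Q → BSTOf Q′ (build f Q′ σ′)) →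
  Arrangement f Q σ s t → BSTOf Q t
arrangement-bst rec (hit s∈) =
  bst-node s∈ (rec _ (length-below s∈)) (rec _ (length-above s∈))
arrangement-bst {Q = Q} rec (between {a} {b} s∉ pa@(a∈ , a<s , _) sb@(b∈ , s<b , _)) =
  bst-node a∈ (rec _ (length-below a∈))
    (bst-node (∈-above⁺ b∈ a<b) (bst-leaf nothing-between)
      (bst-resp (above-above {a} {b} {Q} a<b) (rec _ (length-above b∈))))
  where
  a<b = <-trans a<s s<b
  nothing-between : ∀ {y} → y ∉ below b (above a Q)
  nothing-between y∈ with ∈-below⁻ {b} {above a Q} y∈
  ... | y∈aQ , y<b with ∈-above⁻ {a} {Q} y∈aQ
  ...   | y∈Q , a<y = no-key-between s∉ pa sb y∈Q a<y y<b
arrangement-bst {Q = Q} rec (predOnly {a} s∉ pa@(a∈ , _) none) =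
  bst-node a∈ (rec _ (length-below a∈))
    (bst-leaf λ y∈ → let y∈Q , a<y = ∈-above⁻ {a} {Q} y∈ in no-key-above-pred s∉ pa none y∈Q a<y)
arrangement-bst {Q = Q} rec (succOnly {b} s∉ none sb@(b∈ , _)) =
  bst-node b∈ (bst-leaf λ y∈ → let y∈Q , y<b = ∈-below⁻ {b} {Q} y∈ in no-key-below-succ s∉ none sb y∈Q y<b)
    (rec _ (length-above b∈))

build-bst : ∀ f P σ → length P ≤ f → BSTOf P (build f P σ)
build-bst zero    []      σ _    = bst-leaf λ ()
build-bst (suc f) []      σ _    = bst-leaf λ ()
build-bst (suc f) (p ∷ P) σ fuel =
  arrangement-bst (λ σ′ shorter → build-bst f _ σ′ (≤-pred (≤-trans shorter fuel))) (arrangement f p P σ)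

build-root : ∀ {P} s σ {t} → t ∈ P → t < s → (∀ {y} → y ∈ P → y < s → y ≤ t) →
  root (build (length P) P (s ∷ σ)) ≡ just s ⊎ root (build (length P) P (s ∷ σ)) ≡ just t
build-root {p ∷ P} s σ {t} t∈P t<s t-max = from-view (arrangement (length P) p P (s ∷ σ))
  where
  pred≡t : ∀ {a} → IsPred a s (p ∷ P) → a ≡ t
  pred≡t (a∈ , a<s , a-max) = ≤-antisym (t-max a∈ a<s) (a-max t∈P t<s)
  from-view : ∀ {u} → Arrangement (length P) (p ∷ P) (s ∷ σ) s u → root u ≡ just s ⊎ root u ≡ just t
  from-view (hit _)              = inj₁ refl
  from-view (between _ pa _)     = inj₂ (cong just (pred≡t pa))
  from-view (predOnly _ pa _)    = inj₂ (cong just (pred≡t pa))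
  from-view (succOnly _ none _)  = ⊥-elim (<⇒≱ t<s (none t∈P))

Covers : ℕ → ℕ → List ℕ → Set
Covers lo n σ = ∀ {c} → lo < c → c ≤ n → c ∈ σ

-- If the future searches σ are increasing, exceed lo and cover (lo, n], then every key
-- of P in (lo, n] ends up on the right spine of the arrangement: each level places
-- the least remaining such key and recurses on the keys above it.
build-spine : ∀ f P σ {lo n} → length P ≤ f →
  Increasing σ → (∀ {z} → z ∈ σ → lo < z) → Covers lo n σ →
  ∀ {y} → y ∈ P → lo < y → y ≤ n → y ∈ rspine (build f P σ)
build-spine zero    []      σ       _ _ _ _ ()
build-spine (suc f) []      σ       _ _ _ _ ()
build-spine (suc f) (p ∷ P) []      _ _ _ covers _ lo<y y≤n = case covers lo<y y≤n of λ ()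
build-spine (suc f) (p ∷ P) (s ∷ σ) {lo} {n} fuel inc σ>lo covers {y} y∈P lo<y y≤n =
  from-view (arrangement f p P (s ∷ σ))
  where
  s≤y : s ≤ y
  s≤y = head-least inc (covers lo<y y≤n)
  s<y : s ∉ p ∷ P → s < y
  s<y s∉P = ≤∧≢⇒< s≤y (λ { refl → s∉P y∈P })
  climb : ∀ {r} l → r ∈ p ∷ P → lo < r → r ≤ y →
    y ∈ rspine (node l r (build f (above r (p ∷ P)) (above r (s ∷ σ))))
  climb {r} l r∈P lo<r r≤y with m≤n⇒m<n∨m≡n r≤y
  ... | inj₂ refl = here refl
  ... | inj₁ r<y = there (build-spine f (above r (p ∷ P)) (above r (s ∷ σ))
          (≤-pred (≤-trans (length-above r∈P) fuel)) (increasing-above inc)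
          (λ z∈ → proj₂ (∈-above⁻ {r} {s ∷ σ} z∈))
          (λ r<c c≤n → ∈-above⁺ (covers (<-trans lo<r r<c) c≤n) r<c)
          (∈-above⁺ y∈P r<y) r<y y≤n)
  from-view : ∀ {t} → Arrangement f (p ∷ P) (s ∷ σ) s t → y ∈ rspine t
  from-view (hit s∈P) = climb (build f (below s (p ∷ P)) (below s (s ∷ σ))) s∈P (σ>lo (here refl)) s≤y
  from-view (between s∉P _ (b∈ , s<b , b-min)) =
    there (climb leaf b∈ (<-trans (σ>lo (here refl)) s<b) (b-min y∈P (s<y s∉P)))
  from-view (predOnly s∉P _ none) = ⊥-elim (<⇒≱ (s<y s∉P) (none y∈P))
  from-view (succOnly s∉P _ (b∈ , s<b , b-min)) =
    climb leaf b∈ (<-trans (σ>lo (here refl)) s<b) (b-min y∈P (s<y s∉P))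

leaves : Tree → ℕ
leaves leaf = 1
leaves (node l x r) = leaves l + leaves r

leaves≡ : ∀ t → leaves t ≡ suc (length (inorder t))
leaves≡ leaf = refl
leaves≡ (node l x r) =
  trans (cong₂ _+_ (leaves≡ l) (leaves≡ r)) (cong suc (sym (length-++ (inorder l))))

leaves-resp : ∀ {s t} → inorder s ≡ inorder t → leaves s ≡ leaves t
leaves-resp {s} {t} e = trans (leaves≡ s) (trans (cong (suc ∘ length) e) (sym (leaves≡ t)))

-- In-order traversal of B with the subtrees hs plugged into its leaves, given the
-- traversal of B: the traversals of hs interleaved with the keys of B.
weave : List Tree → List ℕ → List ℕ
weave []       xs       = xs
weave (h ∷ hs) []       = inorder h
weave (h ∷ hs) (x ∷ xs) = inorder h ++ x ∷ weave hs xs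

weave-++ : ∀ hsₗ hsᵣ L x R → length hsₗ ≡ suc (length L) →
  weave (hsₗ ++ hsᵣ) (L ++ x ∷ R) ≡ weave hsₗ L ++ x ∷ weave hsᵣ R
weave-++ (h ∷ [])      hsᵣ []      x R _   = refl
weave-++ (h ∷ _ ∷ _)   hsᵣ []      x R ()
weave-++ (h ∷ hsₗ)     hsᵣ (y ∷ L) x R len =
  trans (cong (λ w → inorder h ++ y ∷ w) (weave-++ hsₗ hsᵣ L x R (suc-injective len)))
        (sym (++-assoc (inorder h) (y ∷ weave hsₗ L) (x ∷ weave hsᵣ R)))

lastT : List Tree → Tree
lastT []            = leaf
lastT (h ∷ [])      = h
lastT (h ∷ h′ ∷ hs) = lastT (h′ ∷ hs)

lastT-++ : ∀ hsₗ {hsᵣ} → 0 < length hsᵣ → lastT (hsₗ ++ hsᵣ) ≡ lastT hsᵣ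
lastT-++ []              _ = refl
lastT-++ (h ∷ [])        {_ ∷ _} _ = refl
lastT-++ (h ∷ h′ ∷ hsₗ)  nonempty  = lastT-++ (h′ ∷ hsₗ) nonempty

cut : ∀ {A : Set} m (xs : List A) → m ≤ length xs → ∃₂ λ ys zs → xs ≡ ys ++ zs × length ys ≡ m
cut zero    xs       _         = [] , xs , refl , refl
cut (suc m) (x ∷ xs) (s≤s m≤) with cut m xs m≤
... | ys , zs , refl , refl = x ∷ ys , zs , refl , refl

length-rest : ∀ {A : Set} (xs : List A) {ys a b} →
  length xs ≡ a → length (xs ++ ys) ≡ a + b → length ys ≡ b
length-rest xs {ys} {a} len-xs len =
  +-cancelˡ-≡ a _ _ (trans (cong (_+ length ys) (sym len-xs)) (trans (sym (length-++ xs)) len))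

record Plugging (B : Tree) (hs : List Tree) (B′ : Tree) : Set where
  field
    inorder-plug : inorder B′ ≡ weave hs (inorder B)
    rspine-plug  : rspine B′ ≡ rspine B ++ rspine (lastT hs)
    root-plug    : ∀ {x} → root B ≡ just x → root B′ ≡ just x

fill-spec : ∀ B hs rest → length hs ≡ leaves B →
  ∃ λ B′ → fill B (hs ++ rest) ≡ (B′ , rest) × Plugging B hs B′
fill-spec leaf (h ∷ []) rest _ =
  h , refl , record { inorder-plug = refl ; rspine-plug = refl ; root-plug = λ () }
fill-spec (node l x r) hs rest len
  with cut (leaves l) hs (subst (leaves l ≤_) (sym len) (m≤m+n (leaves l) (leaves r)))
... | hsₗ , hsᵣ , refl , lenₗ
  with fill-spec l hsₗ (hsᵣ ++ rest) lenₗ | fill-spec r hsᵣ rest (length-rest hsₗ lenₗ len)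
...   | l′ , fillₗ , plugₗ | r′ , fillᵣ , plugᵣ = node l′ x r′ , fills , plugging
  where
  open Plugging
  fills : fill (node l x r) ((hsₗ ++ hsᵣ) ++ rest) ≡ (node l′ x r′ , rest)
  fills rewrite ++-assoc hsₗ hsᵣ rest | fillₗ | fillᵣ = refl
  plugging : Plugging (node l x r) (hsₗ ++ hsᵣ) (node l′ x r′)
  inorder-plug plugging =
    trans (cong₂ (λ u v → u ++ x ∷ v) (inorder-plug plugₗ) (inorder-plug plugᵣ))
          (sym (weave-++ hsₗ hsᵣ (inorder l) x (inorder r) (trans lenₗ (leaves≡ l))))
  rspine-plug plugging =
    cong (x ∷_) (trans (rspine-plug plugᵣ)
                       (cong (λ u → rspine r ++ rspine u) (sym (lastT-++ hsₗ hsᵣ-nonempty))))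
    where
    hsᵣ-nonempty : 0 < length hsᵣ
    hsᵣ-nonempty = subst (0 <_) (sym (trans (length-rest hsₗ lenₗ len) (leaves≡ r))) z<s
  root-plug plugging root≡ = root≡

plugged : Tree → List Tree → Tree
plugged B hs = proj₁ (fill B hs)

plugged-exact : ∀ {B hs B′} → fill B (hs ++ []) ≡ (B′ , []) → plugged B hs ≡ B′
plugged-exact {B} {hs} {B′} fills =
  cong proj₁ (subst (λ zs → fill B zs ≡ (B′ , [])) (++-identityʳ hs) fills)

plug-spec : ∀ {B hs} → length hs ≡ leaves B → Plugging B hs (plugged B hs)
plug-spec {B} {hs} len with fill-spec B hs [] len
... | B′ , fills , plugging = subst (Plugging B hs) (sym (plugged-exact fills)) plugging

-- A tree is its skeleton with the hanging subtrees
-- plugged back in, and a GreedyFuture step replaces the skeleton by the arrangement.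
skeleton : ℕ → Tree → Tree
skeleton k leaf = leaf
skeleton k (node l x r) with k <ᵇ x | x <ᵇ k
... | true  | _     = node (skeleton k l) x leaf
... | false | true  = node leaf x (skeleton k r)
... | false | false = node leaf x leaf

leaves-skeleton : ∀ k t → length (offPath k t) ≡ leaves (skeleton k t)
leaves-skeleton k leaf = refl
leaves-skeleton k (node l x r) with k <ᵇ x | x <ᵇ k
... | true  | _     = trans (length-++ (offPath k l)) (cong (_+ 1) (leaves-skeleton k l))
... | false | true  = cong suc (leaves-skeleton k r)
... | false | false = refl

reassemble : ∀ k t rest → fill (skeleton k t) (offPath k t ++ rest) ≡ (t , rest)
reassemble k leaf rest = refl
reassemble k (node l x r) rest with k <ᵇ x | x <ᵇ k
... | true  | _     rewrite ++-assoc (offPath k l) (r ∷ []) rest | reassemble k l (r ∷ rest) = refl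
... | false | true  rewrite reassemble k r rest = refl
... | false | false = refl

plugged-skeleton : ∀ k t → plugged (skeleton k t) (offPath k t) ≡ t
plugged-skeleton k t = plugged-exact (reassemble k t [])

skeleton⊆path : ∀ k t → inorder (skeleton k t) ⊆ pathKeys k t
skeleton⊆path k (node l x r) y∈ with k <ᵇ x | x <ᵇ k | y∈
... | true  | _     | y∈′ with ∈-++⁻ (inorder (skeleton k l)) y∈′
...   | inj₁ y∈S        = there (skeleton⊆path k l y∈S)
...   | inj₂ (here refl) = here refl
skeleton⊆path k (node l x r) _ | false | true  | here refl  = here refl
skeleton⊆path k (node l x r) _ | false | true  | there y∈S  = there (skeleton⊆path k r y∈S)
skeleton⊆path k (node l x r) _ | false | false | here refl  = here refl

path⊆skeleton : ∀ k t → pathKeys k t ⊆ inorder (skeleton k t)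
path⊆skeleton k (node l x r) y∈ with k <ᵇ x | x <ᵇ k | y∈
... | true  | _     | here refl = key∈node (skeleton k l) leaf
... | true  | _     | there y∈l = ∈-++⁺ˡ (path⊆skeleton k l y∈l)
... | false | true  | here refl = here refl
... | false | true  | there y∈r = there (path⊆skeleton k r y∈r)
... | false | false | here refl = here refl

skeleton⊆inorder : ∀ k t → inorder (skeleton k t) ⊆ inorder t
skeleton⊆inorder k t = path⊆inorder k t ∘ skeleton⊆path k t

skeleton-increasing : ∀ k t → Increasing (inorder t) → Increasing (inorder (skeleton k t))
skeleton-increasing k leaf _ = []
skeleton-increasing k (node l x r) inc with k <ᵇ x | x <ᵇ k | increasing-node⁻ {l} {x} {r} inc
... | true  | _     | incl , _ , l<x , _ =
  increasing-node⁺ {skeleton k l} {x} {leaf}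
    (skeleton-increasing k l incl) [] (l<x ∘ skeleton⊆inorder k l , λ ())
... | false | true  | _ , incr , _ , x<r =
  increasing-node⁺ {leaf} {x} {skeleton k r}
    [] (skeleton-increasing k r incr) ((λ ()) , x<r ∘ skeleton⊆inorder k r)
... | false | false | _ = [] ∷ []

skeleton-bst : ∀ k t → Increasing (inorder t) → BSTOf (pathKeys k t) (skeleton k t)
skeleton-bst k t inc = bst (skeleton-increasing k t inc) (skeleton⊆path k t , path⊆skeleton k t)

-- The GreedyFuture arrangement of the search path, before the hanging subtrees are
-- plugged back in; by definition  step t k σ ≡ plugged (rearranged k t σ) (offPath k t).
rearranged : ℕ → Tree → List ℕ → Tree
rearranged k t σ = build (length (pathKeys k t)) (pathKeys k t) σ

module Step (t : Tree) (k : ℕ) (σ : List ℕ) (inc : Increasing (inorder t)) where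
  open Plugging

  private
    P = pathKeys k t
    hanging = offPath k t

    -- Arrangement and skeleton are search trees on the same keys, hence have the
    -- same traversal.
    same-traversal : inorder (rearranged k t σ) ≡ inorder (skeleton k t)
    same-traversal with build-bst (length P) P σ ≤-refl | skeleton-bst k t inc
    ... | bst incA (A⊆P , P⊆A) | bst incS (S⊆P , P⊆S) =
      increasing-unique incA incS (P⊆S ∘ A⊆P , P⊆A ∘ S⊆P)

    arranged : Plugging (rearranged k t σ) hanging (step t k σ)
    arranged = plug-spec
      (trans (leaves-skeleton k t) (leaves-resp {skeleton k t} {rearranged k t σ} (sym same-traversal)))

    original : Plugging (skeleton k t) hanging t
    original = subst (Plugging (skeleton k t) hanging) (plugged-skeleton k t)
      (plug-spec (leaves-skeleton k t))

  inorder-step : inorder (step t k σ) ≡ inorder t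
  inorder-step = begin
    inorder (step t k σ)                      ≡⟨ inorder-plug arranged ⟩
    weave hanging (inorder (rearranged k t σ)) ≡⟨ cong (weave hanging) same-traversal ⟩
    weave hanging (inorder (skeleton k t))    ≡⟨ sym (inorder-plug original) ⟩
    inorder t                                 ∎
    where open ≡-Reasoning

  root-step : ∀ {x} → root (rearranged k t σ) ≡ just x → root (step t k σ) ≡ just x
  root-step = root-plug arranged

  spine-step : ∀ {x} → x ∈ rspine (rearranged k t σ) → x ∈ rspine (step t k σ)
  spine-step x∈ = subst (_ ∈_) (sym (rspine-plug arranged)) (∈-++⁺ˡ x∈)

  spine-survives : ∀ {x} → x ∈ rspine t → x ∈ pathKeys k t ⊎ x ∈ rspine (step t k σ)
  spine-survives x∈ with ∈-++⁻ (rspine (skeleton k t)) (subst (_ ∈_) (rspine-plug original) x∈)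
  ... | inj₁ x∈S = inj₁ (skeleton⊆path k t (rspine⊆inorder (skeleton k t) x∈S))
  ... | inj₂ x∈H =
    inj₂ (subst (_ ∈_) (sym (rspine-plug arranged)) (∈-++⁺ʳ (rspine (rearranged k t σ)) x∈H))

root-or-right-child : ∀ l y R → RootOrRightChild y (node l y R)
root-or-right-child l y leaf = refl
root-or-right-child l y (node _ _ _) = inj₁ refl

root≤ : ∀ {r j} → just r ≡ just j ⊎ just r ≡ just (suc j) → r ≤ suc j
root≤ (inj₁ refl) = n≤1+n _
root≤ (inj₂ refl) = ≤-refl

right-child : ∀ l r R {x} → root R ≡ just x → RootOrRightChild x (node l r R)
right-child l r (node _ _ _) root≡x = inj₂ (sym (just-injective root≡x))

-- Below a root j, a key on both the search path to j+1 and the right spine is the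
-- root of the right subtree: that root is at least j+1, and if it exceeds j+1 the
-- path continues into its left subtree, which is disjoint from the right spine.
spine-meets-path : ∀ j R {x} → Increasing (inorder R) → (∀ {y} → y ∈ inorder R → j < y) →
  x ∈ pathKeys (suc j) R → x ∈ rspine R → root R ≡ just x
spine-meets-path j (node rl c rr) inc j<R x∈ x∈spine
  with suc j <ᵇ c | c <ᵇ suc j | order (suc j) c | x∈
... | true  | _     | lt _      | here refl  = refl
... | true  | _     | lt _      | there x∈rl =
  ⊥-elim (left-off-spine {rl} {c} {rr} inc (path⊆inorder (suc j) rl x∈rl) x∈spine)
... | false | true  | gt c<j+1  | _          = ⊥-elim (<⇒≱ (j<R (key∈node rl rr)) (≤-pred c<j+1))
... | false | false | eq _      | here refl  = refl

shallow-access : ∀ j t {x} → Increasing (inorder t) →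
  root t ≡ just j ⊎ root t ≡ just (suc j) →
  x ∈ pathKeys (suc j) t → x ≤ j ⊎ x ∈ rspine t → RootOrRightChild x t
shallow-access j (node l r R) {x} inc root≡ x∈ settled
  with suc j <ᵇ r | r <ᵇ suc j | order (suc j) r | x∈ | increasing-node⁻ {l} {r} {R} inc
... | true  | _     | lt j+1<r | _         | _ =
  ⊥-elim (<⇒≱ j+1<r (root≤ root≡))
... | false | false | eq _     | here refl | _ = root-or-right-child l x R
... | false | true  | gt _     | here refl | _ = root-or-right-child l x R
... | false | true  | gt r<j+1 | there x∈R | _ , incR , _ , r<R =
  right-child l r R (spine-meets-path j R incR j<R x∈R (on-spine settled))
  where
  r≡j : r ≡ j
  r≡j = [ just-injective , (λ e → ⊥-elim (<-irrefl (just-injective e) r<j+1)) ]′ root≡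
  j<R : ∀ {y} → y ∈ inorder R → j < y
  j<R = subst (_< _) r≡j ∘ r<R
  j<x = j<R (path⊆inorder (suc j) R x∈R)
  on-spine : x ≤ j ⊎ x ∈ rspine (node l r R) → x ∈ rspine R
  on-spine (inj₁ x≤j)              = ⊥-elim (<⇒≱ j<x x≤j)
  on-spine (inj₂ (here refl))      = ⊥-elim (<-irrefl (sym r≡j) j<x)
  on-spine (inj₂ (there x∈spine)) = x∈spine

upTo-increasing : ∀ m → Increasing (upTo m)
upTo-increasing m = AllPairsₚ.applyUpTo⁺₁ (λ i → i) m (λ i<j _ → i<j)

future-increasing : ∀ n k → Increasing (futureAfter n k)
future-increasing n k =
  AllPairsₚ.map⁺ (AllPairs.map (+-monoʳ-< (suc k)) (upTo-increasing (n ∸ k)))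

future-above : ∀ {n k z} → z ∈ futureAfter n k → k < z
future-above {k = k} z∈ with ∈-map⁻ (λ j → suc k + j) z∈
... | j , _ , refl = s≤s (m≤m+n k j)

future-covers : ∀ {n k} → Covers k n (futureAfter n k)
future-covers {n} {k} {suc c} (s≤s k≤c) c<n =
  subst (_∈ futureAfter n k) (cong suc (m+[n∸m]≡n k≤c))
    (∈-map⁺ (λ j → suc k + j) (∈-upTo⁺ (∸-monoˡ-< c<n k≤c)))

future-next : ∀ {n k} → k < n → ∃ λ σ → futureAfter n k ≡ suc k ∷ σ
future-next {n} {k} k<n with n ∸ k | m<n⇒0<n∸m k<n
... | suc d | _ = map (suc k +_) (applyUpTo suc d) ,
                  cong (_∷ map (suc k +_) (applyUpTo suc d)) (+-identityʳ (suc k))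

module Run (n : ℕ) (T₀ : Tree) (isBST : IsBSTOn n T₀) where

  tree : ℕ → Tree
  tree = trees n T₀

  keys : List ℕ
  keys = map suc (upTo n)

  inorder-tree : ∀ m → inorder (tree m) ≡ keys
  increasing-tree : ∀ m → Increasing (inorder (tree m))

  inorder-tree zero    = isBST
  inorder-tree (suc m) =
    trans (Step.inorder-step (tree m) (suc m) (futureAfter n (suc m)) (increasing-tree m)) (inorder-tree m)
  increasing-tree m =
    subst Increasing (sym (inorder-tree m)) (AllPairsₚ.map⁺ (AllPairs.map s≤s (upTo-increasing n)))

  key-bound : ∀ {m y} → y ∈ inorder (tree m) → y ≤ n
  key-bound {m} y∈ with ∈-map⁻ suc (subst (_ ∈_) (inorder-tree m) y∈)
  ... | i , i∈ , refl = ∈-upTo⁻ i∈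

  key-present : ∀ {m i} → i < n → suc i ∈ inorder (tree m)
  key-present {m} i<n = subst (_ ∈_) (sym (inorder-tree m)) (∈-map⁺ suc (∈-upTo⁺ i<n))

  Settled : ℕ → ℕ → Set
  Settled x m = x ≤ m ⊎ x ∈ rspine (tree m)

  settled-by-access : ∀ {x m} → x ∈ pathKeys (suc m) (tree m) → Settled x (suc m)
  settled-by-access {x} {m} x∈ with x ≤? suc m
  ... | yes x≤ = inj₁ x≤
  ... | no x≰ = inj₂ (Step.spine-step (tree m) (suc m) future (increasing-tree m)
      (build-spine (length P) P future ≤-refl
        (future-increasing n (suc m)) (future-above {n}) (future-covers {n})
        x∈ (≰⇒> x≰) (key-bound {m} (path⊆inorder (suc m) (tree m) x∈))))
    where
    P = pathKeys (suc m) (tree m)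
    future = futureAfter n (suc m)

  settled-step : ∀ {x m} → Settled x m → Settled x (suc m)
  settled-step (inj₁ x≤m) = inj₁ (m≤n⇒m≤1+n x≤m)
  settled-step {m = m} (inj₂ x∈)
    with Step.spine-survives (tree m) (suc m) (futureAfter n (suc m)) (increasing-tree m) x∈
  ... | inj₁ on-path = settled-by-access on-path
  ... | inj₂ on-spine = inj₂ on-spine

  settled-later : ∀ {x i j} → i ≤′ j → Settled x i → Settled x j
  settled-later ≤′-refl          settled = settled
  settled-later (≤′-step i≤′j) settled = settled-step (settled-later i≤′j settled)

  -- For m+1 < n, the tree T_{m+1} is rooted at m+1 or m+2: the next search m+2 becomes
  -- the root, or its predecessor m+1, which was just searched.
  root-next : ∀ m → suc m < n →
    root (tree (suc m)) ≡ just (suc m) ⊎ root (tree (suc m)) ≡ just (suc (suc m))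
  root-next m m+1<n with future-next {n} {suc m} m+1<n
  ... | σ , future≡ = Sum.swap (Sum.map carry carry
      (build-root (suc (suc m)) σ m+1∈P (n<1+n (suc m)) (λ _ → ≤-pred)))
    where
    P = pathKeys (suc m) (tree m)
    m+1∈P : suc m ∈ P
    m+1∈P = key-on-path (suc m) (tree m) (increasing-tree m)
              (key-present {m} (<-trans (n<1+n m) m+1<n))
    carry : ∀ {x} → root (build (length P) P (suc (suc m) ∷ σ)) ≡ just x → root (tree (suc m)) ≡ just x
    carry root≡ = Step.root-step (tree m) (suc m) (futureAfter n (suc m)) (increasing-tree m)
      (subst (λ σ′ → root (build (length P) P σ′) ≡ just _) (sym future≡) root≡)

  revisit : ∀ {x i j} → i < j → j < n →
    x ∈ pathKeys (suc i) (tree i) → x ∈ pathKeys (suc j) (tree j) → RootOrRightChild x (tree j)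
  revisit {j = suc m} (s≤s i≤m) j<n x∈ᵢ x∈ⱼ =
    shallow-access (suc m) (tree (suc m)) (increasing-tree (suc m)) (root-next m j<n) x∈ⱼ
      (settled-later (≤⇒≤′ (s≤s i≤m)) (settled-by-access x∈ᵢ))

lemma6 : (n : ℕ) (T₀ : Tree) → IsBSTOn n T₀ → (x i j : ℕ) → i < n → j < n →
    AccessedDeep n T₀ x i → AccessedDeep n T₀ x j → i ≡ j
lemma6 n T₀ isBST x i j i<n j<n (x∈ᵢ , deepᵢ) (x∈ⱼ , deepⱼ) with <-cmp i j
... | tri< i<j _ _ = ⊥-elim (deepⱼ (Run.revisit n T₀ isBST i<j j<n x∈ᵢ x∈ⱼ))
... | tri≈ _ i≡j _ = i≡j
... | tri> _ _ j<i = ⊥-elim (deepᵢ (Run.revisit n T₀ isBST j<i i<n x∈ⱼ x∈ᵢ))
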